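{- If $G$ is a connected finite simple graph that contains a simplicial vertex, then $\gamma_t(G)\neq 3$ or $\gamma_{\rm gr}^{\rm Z}(G)\neq 3$.
   Context: A vertex $v$ is simplicial if its open neighborhood $N(v)$ induces a complete graph. $N[v]=N(v)\cup\{v\}$. A total dominating set is a set $D$ such that every vertex has a neighbor in $D$; $\gamma_t(G)$ is the minimum size of one. A sequence $(v_1,\ldots,v_k)$ of distinct vertices is a Z-sequence if for every $i\in\{1,\ldots,k\}$, $N(v_i)\setminus\bigcup_{j<i}N[v_j]\ne\emptyset$; $\gamma_{\rm gr}^{\rm Z}(G)$ is the maximum length of a Z-sequence. -}

module Defs where

open import Data.Nat using (ℕ; _≤_; _≥_)
open import Data.Fin using (Fin)
open import Data.List using (List; []; _∷_; length)
open import Data.List.Relation.Unary.Unique.Propositional using (Unique)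
open import Data.List.Relation.Unary.Any using (Any)
open import Data.List.Relation.Unary.All using (All)
open import Data.List.Membership.Propositional using (_∈_)
open import Data.Product using (Σ; ∃; _×_; _,_)
open import Data.Sum using (_⊎_)
open import Relation.Nullary using (¬_)
open import Relation.Binary.PropositionalEquality using (_≡_)

record Graph (n : ℕ) : Set₁ where
  field
    Adj   : Fin n → Fin n → Set
    sym   : ∀ {u v} → Adj u v → Adj v u
    irrefl : ∀ {v} → ¬ Adj v v
open Graph public

module _ {n : ℕ} (G : Graph n) where

  data Walk : Fin n → Fin n → Set where
    here : ∀ {v} → Walk v v
    step : ∀ {u v w} → Adj G u v → Walk v w → Walk u w

  Connected : Set
  Connected = ∀ u v → Walk u v

  InN : Fin n → Fin n → Set
  InN u v = Adj G v u

  InN[] : Fin n → Fin n → Set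
  InN[] u v = (u ≡ v) ⊎ Adj G v u

  Simplicial : Fin n → Set
  Simplicial v = ∀ x y → Adj G v x → Adj G v y → ¬ (x ≡ y) → Adj G x y

  IsTDS : List (Fin n) → Set
  IsTDS D = Unique D × (∀ v → Any (λ d → Adj G v d) D)

  TotalDomNumberIs : ℕ → Set
  TotalDomNumberIs k =
    (Σ (List (Fin n)) λ D → IsTDS D × length D ≡ k)
    × (∀ D → IsTDS D → k ≤ length D)

  -- Z-sequence condition. The list is stored in reverse order:
  -- (v ∷ prev) means v is the last vertex and prev are the earlier ones.
  -- v must have a neighbour outside ⋃_{w ∈ prev} N[w].
  ZStep : Fin n → List (Fin n) → Set
  ZStep v prev = ∃ λ u → Adj G v u × All (λ w → ¬ InN[] u w) prev

  data ZRev : List (Fin n) → Set where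
    []  : ZRev []
    _∷_ : ∀ {v prev} → ZStep v prev → ZRev prev → ZRev (v ∷ prev)

  IsZSeq : List (Fin n) → Set
  IsZSeq s = Unique s × ZRev s

  ZGrundyNumberIs : ℕ → Set
  ZGrundyNumberIs k =
    (Σ (List (Fin n)) λ s → IsZSeq s × length s ≡ k)
    × (∀ s → IsZSeq s → length s ≤ k)

-- Let x be simplicial and p a neighbour of x; simpliciality gives N[x] ⊆ N[p]. If γ_t(G) ≥ 3,
-- no edge totally dominates G, so every edge leaves some vertex outside both closed
-- neighbourhoods, and a walk from that vertex yields a vertex at distance two. Doing this
-- three times produces footprints turning (x, p, q, s) into a Z-sequence of length 4.
-- Adjacency is not decidable, so these existence claims hold only under double negation,
-- which suffices because the goal is ⊥.
module Submission where

open import Defs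
open import Data.Nat using (ℕ; zero; suc; _≤_; s≤s)
open import Data.Fin using (Fin; zero; suc)
open import Data.Fin.Properties using (_≟_)
open import Data.Product using (∃; ∃₂; _×_; _,_)
open import Data.Sum using (inj₁; inj₂)
open import Data.Empty using (⊥-elim)
open import Data.List using ([]; _∷_; length)
open import Data.List.Relation.Unary.Any using (Any; here; there; satisfied)
open import Data.List.Relation.Unary.All as All using ([]; _∷_)
open import Data.List.Relation.Unary.AllPairs using ([]; _∷_)
open import Data.List.Relation.Unary.Unique.Propositional using (Unique)
open import Function using (_∘_)
open import Relation.Nullary using (¬_; yes; no)
open import Relation.Binary.PropositionalEquality using (_≡_; refl)

¬¬-pull-Fin : ∀ n {P : Fin n → Set} → (∀ i → ¬ ¬ P i) → ¬ ¬ (∀ i → P i)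
¬¬-pull-Fin zero    ¬¬P ¬∀P = ¬∀P λ ()
¬¬-pull-Fin (suc n) ¬¬P ¬∀P =
  ¬¬P zero λ P₀ → ¬¬-pull-Fin n (¬¬P ∘ suc) λ P₊ → ¬∀P λ { zero → P₀ ; (suc i) → P₊ i }

module _ {n : ℕ} (G : Graph n) where

  ZRev⇒Unique : ∀ {s} → ZRev G s → Unique s
  ZRev⇒Unique []                      = []
  ZRev⇒Unique ((u , vu , u∉N[w]) ∷ z) =
    All.map (λ u∉N[w] v≡w → u∉N[w] (inj₂ (adj-subst v≡w vu))) u∉N[w] ∷ ZRev⇒Unique z
    where
    adj-subst : ∀ {v w} → v ≡ w → Adj G v u → Adj G w u
    adj-subst refl a = a

  simplicial⇒N[]⊆N[] : ∀ {x p t} → Simplicial G x → Adj G x p → InN[] G t x → InN[] G t p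
  simplicial⇒N[]⊆N[] _ xp (inj₁ refl) = inj₂ (Graph.sym G xp)
  simplicial⇒N[]⊆N[] {p = p} {t} simp xp (inj₂ xt) with p ≟ t
  ... | yes refl = inj₁ refl
  ... | no p≢t   = inj₂ (simp p t xp xt p≢t)

  walk-from-other⇒neighbour : ∀ {t p} → Walk G t p → ¬ t ≡ p → ∃ (Adj G t)
  walk-from-other⇒neighbour here               t≢p = ⊥-elim (t≢p refl)
  walk-from-other⇒neighbour (step {v = v} tv _) _   = v , tv

  walk⇒distance-two : ∀ {u c} → Walk G u c → ¬ InN[] G u c →
    ¬ ¬ (∃₂ λ a b → ¬ InN[] G a c × Adj G a b × Adj G c b)
  walk⇒distance-two here u∉N[c] _ = u∉N[c] (inj₁ refl)
  walk⇒distance-two {u} {c} (step {v = v} uv w) u∉N[c] ¬goal with v ≟ c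
  ... | yes refl = u∉N[c] (inj₂ (Graph.sym G uv))
  ... | no v≢c   = walk⇒distance-two w v∉N[c] ¬goal
    where
    v∉N[c] : ¬ InN[] G v c
    v∉N[c] (inj₁ v≡c) = v≢c v≡c
    v∉N[c] (inj₂ cv)  = ¬goal (u , v , u∉N[c] , uv , cv)

  module _ (γₜ≥3 : ∀ D → IsTDS G D → 3 ≤ length D) where

    edge-leaves-undominated : ∀ {p q} → Adj G p q →
      ¬ ¬ (∃ λ t → ¬ InN[] G t p × ¬ InN[] G t q)
    edge-leaves-undominated {p} {q} pq ¬goal =
      ¬¬-pull-Fin n dominated λ dom → ¬3≤2 (γₜ≥3 (p ∷ q ∷ []) (unique , dom))
      where
      irrefl′ : ∀ {a b} → Adj G a b → ¬ a ≡ b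
      irrefl′ ab refl = Graph.irrefl G ab

      unique : Unique (p ∷ q ∷ [])
      unique = (irrefl′ pq ∷ []) ∷ [] ∷ []

      ¬3≤2 : ¬ 3 ≤ 2
      ¬3≤2 (s≤s (s≤s ()))

      -- A vertex missed by {p, q} lies outside N[p] ∪ N[q], since p and q are adjacent.
      dominated : ∀ t → ¬ ¬ (Any (Adj G t) (p ∷ q ∷ []))
      dominated t ¬dom = ¬goal (t , t∉N[ pq ] ¬tp ¬tq , t∉N[ Graph.sym G pq ] ¬tq ¬tp)
        where
        ¬tp : ¬ Adj G t p
        ¬tp = ¬dom ∘ here
        ¬tq : ¬ Adj G t q
        ¬tq = ¬dom ∘ there ∘ here
        t∉N[_] : ∀ {a b} → Adj G a b → ¬ Adj G t a → ¬ Adj G t b → ¬ InN[] G t a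
        t∉N[ ab ] _   ¬tb (inj₁ refl) = ¬tb ab
        t∉N[ ab ] ¬ta _   (inj₂ at)   = ¬ta (Graph.sym G at)

¬4≤3 : ¬ 4 ≤ 3
¬4≤3 (s≤s (s≤s (s≤s ())))

theorem3p6 : ∀ {n : ℕ} (G : Graph n) → Connected G → ∃ (λ (v : Fin n) → Simplicial G v) →
    ¬ (TotalDomNumberIs G 3 × ZGrundyNumberIs G 3)
theorem3p6 G conn (x , simp) (((_ , (_ , dom) , _) , γₜ≥3) , (_ , γZ≤3)) =
  let (y , xy) = satisfied (dom x) in
  edge-leaves-undominated G γₜ≥3 xy λ (w , w∉N[x] , _) →
  walk⇒distance-two G (conn w x) w∉N[x] λ (q′ , p , q′∉N[x] , q′p , xp) →
  edge-leaves-undominated G γₜ≥3 (Graph.sym G q′p) λ (t₀ , t₀∉N[p] , _) →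
  walk⇒distance-two G (conn t₀ p) t₀∉N[p] λ (r , q , r∉N[p] , rq , pq) →
  edge-leaves-undominated G γₜ≥3 pq λ (t , t∉N[p] , t∉N[q]) →
  let (s , ts) = walk-from-other⇒neighbour G (conn t p) (t∉N[p] ∘ inj₁)
      ⊆N[p] : ∀ {v} → InN[] G v x → InN[] G v p
      ⊆N[p] = simplicial⇒N[]⊆N[] G simp xp
      zseq : ZRev G (s ∷ q ∷ p ∷ x ∷ [])
      zseq = (t  , Graph.sym G ts    , t∉N[q] ∷ t∉N[p] ∷ t∉N[p] ∘ ⊆N[p] ∷ [])
           ∷ (r  , Graph.sym G rq    , r∉N[p] ∷ r∉N[p] ∘ ⊆N[p] ∷ [])
           ∷ (q′ , Graph.sym G q′p   , q′∉N[x] ∷ [])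
           ∷ (p  , xp                , [])
           ∷ []
  in ¬4≤3 (γZ≤3 _ (ZRev⇒Unique G zseq , zseq))
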